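{- Let $P$ be a range-restricted $\mathrm{CHR}(C)$ program and $G$ a goal, and let $\mathit{Conf}$ be the set of configurations $\langle G',S,B\rangle_n$ of the abstract semantics $\omega_o$ for $G$ and $P$, which (as assumed throughout) contain only constants and variables from a fixed finite set. Then the relation $\leq$ on $\mathit{Conf}$ defined below is a well-quasi-order on $\mathit{Conf}$.
   Context: $\mathrm{CHR}(C)$ is Constraint Handling Rules over a signature with no function symbols of arity $>0$ (terms are variables and constants), whose only built-in constraints are equalities $s=t$ (plus $true$, $false$), interpreted by the constraint theory $\mathcal{CT}$ of syntactic equality on the Herbrand universe. A CHR constraint is an atom with a user-defined predicate; an identified CHR constraint $c\#i$ is a CHR constraint $c$ with a unique natural-number identifier $i$. A rule has the form $r\,@\,H^k\setminus H^h \Longleftrightarrow g\mid B$ with $H^k,H^h$ multisets of CHR constraints (not both empty), $g$ a conjunction of built-ins, $B$ a multiset of built-in and CHR constraints; it is range-restricted if every variable of $B$ and $g$ occurs in $H^k$ or $H^h$. A program is a finite sequence of rules; a goal is a multiset of constraints. Configurations of $\omega_o$ have the form $\langle G,S,B\rangle_n$: $G$ a goal, $S$ a set of identified CHR constraints, $B$ a conjunction of built-ins, $n$ the next free identifier. Standing assumption (made by the paper): for given $G$ and range-restricted $P$, the set $\mathit{Conf}$ of all configurations uses only a finite number of constants and variables. The quasi-order: $\langle G_1,S_1,B_1\rangle_i \leq \langle G_2,S_2,B_2\rangle_j$ iff (i) for every constraint $c\in G_1$, the multiplicity of $c$ in $G_1$ is at most its multiplicity in $G_2$; (ii) for every $c$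 with $c\#i\in S_1$ for some $i$, $|\{i : c\#i\in S_1\}| \leq |\{i: c\#i\in S_2\}|$; (iii) $B_1$ is logically equivalent to $B_2$. A well-quasi-order is a reflexive transitive relation $\leq$ on $X$ such that every infinite sequence $x_0,x_1,\dots$ in $X$ has indices $i<j$ with $x_i\leq x_j$. -}

module Defs where

open import Level using (0ℓ)
open import Data.Nat using (ℕ; _≤_; _<_)
open import Data.Fin using (Fin)
import Data.Fin.Properties as FinP
open import Data.Vec using (Vec)
import Data.Vec.Properties as VecP
open import Data.Product using (Σ; ∃; _×_; _,_; proj₁; proj₂)
import Data.Product.Properties as ProdP
open import Data.List using (List; map; filter; length)
open import Data.List.Membership.Propositional using (_∈_)
open import Data.List.Relation.Unary.All using (All)
open import Data.List.Relation.Unary.Unique.Propositional using (Unique)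
open import Data.Unit using (⊤)
open import Data.Empty using (⊥)
open import Function using (_⇔_; _∘_)
open import Function.Definitions using (Injective)
open import Relation.Binary.PropositionalEquality using (_≡_; refl; cong)
open import Relation.Binary.Definitions using (DecidableEquality)
open import Relation.Nullary using (yes; no)

-- Signature: finitely many variables (Fin nv), finitely many constants
-- that may occur (Fin nc), finitely many user-defined predicates (Fin np)
-- with arities.  No function symbols of arity > 0.

record Sig : Set where
  field
    nv : ℕ
    nc : ℕ
    np : ℕ
    ar : Fin np → ℕ
open Sig public

data Term (Σ' : Sig) : Set where
  var : Fin (nv Σ') → Term Σ'
  con : Fin (nc Σ') → Term Σ'

_≟T_ : ∀ {Σ'} → DecidableEquality (Term Σ')
var x ≟T var y with x FinP.≟ y
... | yes refl = yes refl
... | no ne = no λ { refl → ne refl }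
var x ≟T con y = no λ ()
con x ≟T var y = no λ ()
con x ≟T con y with x FinP.≟ y
... | yes refl = yes refl
... | no ne = no λ { refl → ne refl }

CHRC : Sig → Set
CHRC Σ' = Σ (Fin (np Σ')) λ p → Vec (Term Σ') (ar Σ' p)

_≟C_ : ∀ {Σ'} → DecidableEquality (CHRC Σ')
_≟C_ = ProdP.≡-dec FinP._≟_ (VecP.≡-dec _≟T_)

data BuiltIn (Σ' : Sig) : Set where
  _≐_   : Term Σ' → Term Σ' → BuiltIn Σ'
  true  : BuiltIn Σ'
  false : BuiltIn Σ'

_≟B_ : ∀ {Σ'} → DecidableEquality (BuiltIn Σ')
(s ≐ t) ≟B (s' ≐ t') with s ≟T s' | t ≟T t'
... | yes refl | yes refl = yes refl
... | no ne | _ = no λ { refl → ne refl }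
... | yes _ | no ne = no λ { refl → ne refl }
(s ≐ t) ≟B true = no λ ()
(s ≐ t) ≟B false = no λ ()
true ≟B (s ≐ t) = no λ ()
true ≟B true = yes refl
true ≟B false = no λ ()
false ≟B (s ≐ t) = no λ ()
false ≟B true = no λ ()
false ≟B false = yes refl

data Constraint (Σ' : Sig) : Set where
  bi  : BuiltIn Σ' → Constraint Σ'
  chr : CHRC Σ' → Constraint Σ'

_≟K_ : ∀ {Σ'} → DecidableEquality (Constraint Σ')
bi b ≟K bi b' with b ≟B b'
... | yes refl = yes refl
... | no ne = no λ { refl → ne refl }
bi b ≟K chr c = no λ ()
chr c ≟K bi b = no λ ()
chr c ≟K chr c' with c ≟C c'
... | yes refl = yes refl
... | no ne = no λ { refl → ne refl }

-- G : goal, a multiset of constraints (list; multiplicity = count)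
--  S : set of identified CHR constraints c#i (list of pairs (c , i) with
--      pairwise distinct identifiers)
--  B : conjunction of built-ins (list, read as conjunction)
--  n : next free identifier

record Conf (Σ' : Sig) : Set where
  constructor ⟨_,_,_⟩[_]_
  field
    goal  : List (Constraint Σ')
    store : List (CHRC Σ' × ℕ)
    ids-unique : Unique (map proj₂ store)
    bstore : List (BuiltIn Σ')
    next  : ℕ
open Conf public

mult : ∀ {Σ'} → Constraint Σ' → List (Constraint Σ') → ℕ
mult c G = length (filter (c ≟K_) G)

-- |{ i : c#i ∈ S }|  (identifiers in S are distinct)
idcount : ∀ {Σ'} → CHRC Σ' → List (CHRC Σ' × ℕ) → ℕ
idcount c S = length (filter ((c ≟C_) ∘ proj₁) S)

-- Constraint theory CT: syntactic equality on the Herbrand universe.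
-- The Herbrand universe is the set K of constants of the signature; the
-- constants occurring in configurations are named by an injective map
-- ι : Fin nc → K (distinct constant symbols denote distinct elements).

module _ {Σ' : Sig} {K : Set} (ι : Fin (nc Σ') → K) where

  ⟦_⟧T : Term Σ' → (Fin (nv Σ') → K) → K
  ⟦ var x ⟧T ρ = ρ x
  ⟦ con k ⟧T ρ = ι k

  ⟦_⟧B : BuiltIn Σ' → (Fin (nv Σ') → K) → Set
  ⟦ s ≐ t ⟧B ρ = ⟦ s ⟧T ρ ≡ ⟦ t ⟧T ρ
  ⟦ true ⟧B ρ = ⊤
  ⟦ false ⟧B ρ = ⊥

  Holds : List (BuiltIn Σ') → (Fin (nv Σ') → K) → Set
  Holds B ρ = All (λ b → ⟦ b ⟧B ρ) B

  _≡CT_ : List (BuiltIn Σ') → List (BuiltIn Σ') → Set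
  B₁ ≡CT B₂ = ∀ (ρ : Fin (nv Σ') → K) → Holds B₁ ρ ⇔ Holds B₂ ρ

  _⊑_ : Conf Σ' → Conf Σ' → Set
  C₁ ⊑ C₂ =
      (∀ c → c ∈ goal C₁ → mult c (goal C₁) ≤ mult c (goal C₂))
    × (∀ c → (∃ λ i → (c , i) ∈ store C₁) →
         idcount c (store C₁) ≤ idcount c (store C₂))
    × (bstore C₁ ≡CT bstore C₂)

record IsWQO {X : Set} (_≼_ : X → X → Set) : Set where
  field
    refl′  : ∀ x → x ≼ x
    trans′ : ∀ {x y z} → x ≼ y → y ≼ z → x ≼ z
    good   : (f : ℕ → X) → ∃ λ i → ∃ λ j → i < j × f i ≼ f j

-- Only finitely many constraints, constraint heads and built-ins can occur, so
-- ⊑ contains the coordinatewise comparison of finitely many coordinates: the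
-- multiplicity of each possible constraint in G and in S, compared by ≤, and
-- for each possible built-in whether it occurs in B, compared by equality (two
-- built-in stores with the same elements are CT-equivalent). Each coordinate
-- order is a well-quasi-order and, by Dickson's lemma, so is their intersection.
-- Constructively this is carried out for almost-full relations, the inductive
-- form of well-quasi-orders of Vytiniotis, Coquand and Wahlstedt, which are
-- closed under finite intersections by Coquand's argument.

module Submission where

open import Defs
open import Data.Fin using (Fin)
open import Function.Definitions using (Injective)
open import Relation.Binary.PropositionalEquality using (_≡_)

open import Level using (0ℓ)
open import Data.Bool using (Bool; true; false; T)
open import Data.Nat using (ℕ; zero; suc; _≤_; _<_; z≤n; s≤s; _<?_)
open import Data.Nat.Properties using (≤-refl; ≤-trans; <-≤-trans; ≮⇒≥)
open import Data.Nat.Induction using (<-wellFounded)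
open import Data.Product using (Σ; ∃; _×_; _,_; proj₁; proj₂; uncurry)
open import Data.Sum using (_⊎_; inj₁; inj₂; [_,_]; map₁)
import Data.Sum as Sum
open import Data.List
  using (List; []; _∷_; map; filter; length; _++_; concatMap; cartesianProductWith; allFin)
open import Data.List.Properties using (filter-some)
open import Data.List.Membership.Propositional using (_∈_; find)
open import Data.List.Membership.Propositional.Properties
  using (∈-map⁺; ∈-++⁺ˡ; ∈-++⁺ʳ; ∈-concatMap⁺; ∈-cartesianProductWith⁺; ∈-allFin)
import Data.List.Membership.DecPropositional as DecMembership
open import Data.List.Relation.Binary.Subset.Propositional using (_⊆_)
open import Data.List.Relation.Unary.Any using (Any; here; there)
import Data.List.Relation.Unary.Any as Any
open import Data.List.Relation.Unary.All using (All; []; _∷_)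
import Data.List.Relation.Unary.All as All
open import Data.List.Relation.Unary.All.Properties using (anti-mono)
open import Data.List.Relation.Unary.Enumerates.Setoid using (IsEnumeration)
open import Data.Vec using (Vec)
open import Function using (_∘_; _on_; mk⇔)
open import Function.Construct.Identity using (⇔-id)
open import Function.Construct.Composition using (_⇔-∘_)
open import Induction.WellFounded using (Acc; acc; WellFounded)
open import Relation.Binary using (Rel; _⇒_; Decidable)
open import Relation.Binary.Construct.Constant using (Const)
open import Relation.Binary.Construct.Intersection using (_∩_)
open import Relation.Binary.Construct.Union using (_∪_)
open import Relation.Binary.PropositionalEquality using (refl; sym; cong; subst; setoid)
open import Relation.Nullary using (Dec; yes; no; ¬_)
open import Relation.Nullary.Decidable using (isYes; toWitness; fromWitness)
import Relation.Unary as U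

Enumerable : Set → Set
Enumerable A = ∃ λ (xs : List A) → IsEnumeration (setoid A) xs

Shift : {X : Set} → Rel X 0ℓ → X → Rel X 0ℓ
Shift R x y z = R y z ⊎ R x y

OnFirst : {X : Set} → U.Pred X 0ℓ → Rel X 0ℓ
OnFirst V y _ = V y

-- Inductive form of "every f : ℕ → X has i < j with R (f i) (f j)": either R is
-- total, or whatever x comes first, Shift R x is again almost full.
data AlmostFull {X : Set} : Rel X 0ℓ → Set₁ where
  now   : ∀ {R} → (∀ x y → R x y) → AlmostFull R
  later : ∀ {R} → (∀ x → AlmostFull (Shift R x)) → AlmostFull R

module _ {X : Set} where

  almostFull-mono : {R S : Rel X 0ℓ} → R ⇒ S → AlmostFull R → AlmostFull S
  almostFull-mono R⇒S (now R-all) = now λ x y → R⇒S (R-all x y)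
  almostFull-mono R⇒S (later af) = later λ x → almostFull-mono (Sum.map R⇒S R⇒S) (af x)

  almostFull⇒good : {R : Rel X 0ℓ} → AlmostFull R →
    (f : ℕ → X) → ∃ λ i → ∃ λ j → i < j × R (f i) (f j)
  almostFull⇒good (now R-all) f = 0 , 1 , s≤s z≤n , R-all (f 0) (f 1)
  almostFull⇒good (later af) f with almostFull⇒good (af (f 0)) (f ∘ suc)
  ... | i , j , i<j , inj₁ r = suc i , suc j , s≤s i<j , r
  ... | i , j , i<j , inj₂ r = 0 , suc i , s≤s z≤n , r

  almostFull⇒IsWQO : {R _≼_ : Rel X 0ℓ} → AlmostFull R → R ⇒ _≼_ →
    (∀ x → x ≼ x) → (∀ {x y z} → x ≼ y → y ≼ z → x ≼ z) → IsWQO _≼_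
  almostFull⇒IsWQO af R⇒≼ ≼-refl ≼-trans = record
    { refl′  = ≼-refl
    ; trans′ = ≼-trans
    ; good   = λ f → let i , j , i<j , r = almostFull⇒good af f in i , j , i<j , R⇒≼ r
    }

almostFull-on : {X Y : Set} {R : Rel X 0ℓ} (f : Y → X) → AlmostFull R → AlmostFull (R on f)
almostFull-on f (now R-all) = now λ a b → R-all (f a) (f b)
almostFull-on f (later af) = later λ y → almostFull-on f (af (f y))

-- Once x has occurred, a later x′ either satisfies x′ < x, and induction on Acc
-- applies, or x′ ≮ x relates x to x′ outright.
module _ {X : Set} {_<ₓ_ : Rel X 0ℓ} (_<ₓ?_ : Decidable _<ₓ_) where

  private
    NotAbove : Rel X 0ℓ
    NotAbove x y = ¬ y <ₓ x

  acc⇒almostFull-Shift : ∀ {x} → Acc _<ₓ_ x → AlmostFull (Shift NotAbove x)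
  acc⇒almostFull-Shift {x} (acc rs) = later λ x′ → step x′ (x′ <ₓ? x)
    where
    step : ∀ x′ → Dec (x′ <ₓ x) → AlmostFull (Shift (Shift NotAbove x) x′)
    step x′ (yes x′<x) = almostFull-mono (Sum.map inj₁ inj₁) (acc⇒almostFull-Shift (rs x′<x))
    step x′ (no x′≮x) = now λ _ _ → inj₂ (inj₂ x′≮x)

  wellFounded⇒almostFull : WellFounded _<ₓ_ → AlmostFull NotAbove
  wellFounded⇒almostFull wf = later λ x → acc⇒almostFull-Shift (wf x)

≤-almostFull : AlmostFull _≤_
≤-almostFull = almostFull-mono ≮⇒≥ (wellFounded⇒almostFull _<?_ <-wellFounded)

≡-almostFull-Bool : AlmostFull (_≡_ {A = Bool})
≡-almostFull-Bool = later λ x₁ → later λ x₂ → now (pigeonhole x₁ x₂)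
  where
  pigeonhole : ∀ x₁ x₂ y z → (y ≡ z ⊎ x₁ ≡ y) ⊎ (x₂ ≡ y ⊎ x₁ ≡ x₂)
  pigeonhole true  true  _     _ = inj₂ (inj₂ refl)
  pigeonhole false false _     _ = inj₂ (inj₂ refl)
  pigeonhole true  false true  _ = inj₁ (inj₂ refl)
  pigeonhole true  false false _ = inj₂ (inj₁ refl)
  pigeonhole false true  true  _ = inj₂ (inj₁ refl)
  pigeonhole false true  false _ = inj₁ (inj₂ refl)

-- Coquand's proof, as in Vytiniotis, Coquand and Wahlstedt, "Stop when you are
-- almost-full": unfolding one argument of an intersection leaves a leftover
-- conjunct that depends on the first element only, which is absorbed by the two
-- auxiliary lemmas, first for a constant and then for a unary leftover.
module _ {X : Set} where

  private
    ⊎-both : {A p q : Set} → A ⊎ p → A ⊎ q → A ⊎ (p × q)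
    ⊎-both (inj₁ a) _        = inj₁ a
    ⊎-both (inj₂ _) (inj₁ a) = inj₁ a
    ⊎-both (inj₂ p) (inj₂ q) = inj₂ (p , q)

  almostFull-∪-Const : {P Q A : Rel X 0ℓ} {p q : Set} →
    AlmostFull P → AlmostFull Q → P ⇒ A ∪ Const p → Q ⇒ A ∪ Const q →
    AlmostFull (A ∪ (Const p ∩ Const q))
  almostFull-∪-Const (now P-all) afQ P⇒ Q⇒ =
    almostFull-mono (λ q → ⊎-both (P⇒ (P-all _ _)) (Q⇒ q)) afQ
  almostFull-∪-Const (later afP) afQ P⇒ Q⇒ = later λ x →
    almostFull-mono [ Sum.map inj₁ inj₁ , inj₁ ∘ inj₂ ]
      (almostFull-∪-Const (afP x) afQ
        [ map₁ inj₁ ∘ P⇒ , map₁ inj₂ ∘ P⇒ ] (map₁ inj₁ ∘ Q⇒))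

  almostFull-∪-OnFirst : {P Q A : Rel X 0ℓ} {V W : U.Pred X 0ℓ} →
    AlmostFull P → AlmostFull Q → P ⇒ A ∪ OnFirst V → Q ⇒ A ∪ OnFirst W →
    AlmostFull (A ∪ (OnFirst V ∩ OnFirst W))
  almostFull-∪-OnFirst (now P-all) afQ P⇒ Q⇒ =
    almostFull-mono (λ q → ⊎-both (P⇒ (P-all _ _)) (Q⇒ q)) afQ
  almostFull-∪-OnFirst afP (now Q-all) P⇒ Q⇒ =
    almostFull-mono (λ p → ⊎-both (P⇒ p) (Q⇒ (Q-all _ _))) afP
  almostFull-∪-OnFirst {A = A} {V} {W} afP@(later afP′) afQ@(later afQ′) P⇒ Q⇒ = later λ x →
    almostFull-mono reassoc
      (almostFull-∪-Const
        (almostFull-∪-OnFirst (afP′ x) afQ (Shift-∪ P⇒) (map₁ inj₁ ∘ Q⇒))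
        (almostFull-∪-OnFirst afP (afQ′ x) (map₁ inj₁ ∘ P⇒) (Shift-∪ Q⇒))
        (λ { (inj₁ a) → inj₁ (inj₁ a)
           ; (inj₂ (inj₁ v , w)) → inj₁ (inj₂ (v , w))
           ; (inj₂ (inj₂ v , _)) → inj₂ v })
        (λ { (inj₁ a) → inj₁ (inj₁ a)
           ; (inj₂ (v , inj₁ w)) → inj₁ (inj₂ (v , w))
           ; (inj₂ (_ , inj₂ w)) → inj₂ w }))
    where
    Shift-∪ : ∀ {x} {R : Rel X 0ℓ} {B : Rel X 0ℓ} →
      R ⇒ A ∪ B → Shift R x ⇒ Shift A x ∪ Shift B x
    Shift-∪ R⇒ = [ Sum.map inj₁ inj₁ ∘ R⇒ , Sum.map inj₂ inj₂ ∘ R⇒ ]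

    reassoc : ∀ {x} →
      (Shift A x ∪ (OnFirst V ∩ OnFirst W)) ∪ (Const (V x) ∩ Const (W x)) ⇒
      Shift (A ∪ (OnFirst V ∩ OnFirst W)) x
    reassoc (inj₁ (inj₁ (inj₁ a))) = inj₁ (inj₁ a)
    reassoc (inj₁ (inj₁ (inj₂ a))) = inj₂ (inj₁ a)
    reassoc (inj₁ (inj₂ vw))       = inj₁ (inj₂ vw)
    reassoc (inj₂ vw)              = inj₂ (inj₂ vw)

  almostFull-∩ : {R S : Rel X 0ℓ} → AlmostFull R → AlmostFull S → AlmostFull (R ∩ S)
  almostFull-∩ (now R-all) afS = almostFull-mono (λ s → R-all _ _ , s) afS
  almostFull-∩ afR (now S-all) = almostFull-mono (λ r → r , S-all _ _) afR
  almostFull-∩ afR@(later afR′) afS@(later afS′) = later λ x →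
    almostFull-∪-OnFirst (almostFull-∩ (afR′ x) afS) (almostFull-∩ afR (afS′ x))
      (λ { (inj₁ r , s) → inj₁ (r , s) ; (inj₂ r , _) → inj₂ r })
      (λ { (r , inj₁ s) → inj₁ (r , s) ; (_ , inj₂ s) → inj₂ s })

module _ {X C : Set} {R : C → Rel X 0ℓ} where

  almostFull-All : (∀ c → AlmostFull (R c)) →
    (cs : List C) → AlmostFull (λ a b → All (λ c → R c a b) cs)
  almostFull-All af []       = now λ _ _ → []
  almostFull-All af (c ∷ cs) =
    almostFull-mono (uncurry _∷_) (almostFull-∩ (af c) (almostFull-All af cs))

  almostFull-∀ : Enumerable C → (∀ c → AlmostFull (R c)) →
    AlmostFull (λ a b → ∀ c → R c a b)
  almostFull-∀ (cs , ∈cs) af =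
    almostFull-mono (λ all c → All.lookup all (∈cs c)) (almostFull-All af cs)

Vec-enumerable : {A : Set} → Enumerable A → ∀ k → Enumerable (Vec A k)
Vec-enumerable _ zero = Vec.[] ∷ [] , λ { Vec.[] → here refl }
Vec-enumerable (as , ∈as) (suc k) with vs , ∈vs ← Vec-enumerable (as , ∈as) k =
  cartesianProductWith Vec._∷_ as vs ,
  λ { (a Vec.∷ v) → ∈-cartesianProductWith⁺ Vec._∷_ (∈as a) (∈vs v) }

Σ-enumerable : ∀ {n} {B : Fin n → Set} → (∀ i → Enumerable (B i)) → Enumerable (Σ (Fin n) B)
Σ-enumerable {n} {B} enumB = concatMap pairs (allFin n) ,
  λ { (i , b) → ∈-concatMap⁺ pairs
        (Any.map (λ { refl → ∈-map⁺ (i ,_) (proj₂ (enumB i) b) }) (∈-allFin i)) }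
  where
  pairs : (i : Fin n) → List (Σ (Fin n) B)
  pairs i = map (i ,_) (proj₁ (enumB i))

module _ (Σ' : Sig) where

  Term-enumerable : Enumerable (Term Σ')
  Term-enumerable = map var (allFin _) ++ map con (allFin _) , ∈terms
    where
    ∈terms : IsEnumeration (setoid (Term Σ')) (map var (allFin _) ++ map con (allFin _))
    ∈terms (var x) = ∈-++⁺ˡ (∈-map⁺ var (∈-allFin x))
    ∈terms (con k) = ∈-++⁺ʳ (map var (allFin _)) (∈-map⁺ con (∈-allFin k))

  CHRC-enumerable : Enumerable (CHRC Σ')
  CHRC-enumerable = Σ-enumerable λ p → Vec-enumerable Term-enumerable (ar Σ' p)

  BuiltIn-enumerable : Enumerable (BuiltIn Σ')
  BuiltIn-enumerable = equations ++ true ∷ false ∷ [] , ∈builtIns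
    where
    ts : List (Term Σ')
    ts = proj₁ Term-enumerable
    equations : List (BuiltIn Σ')
    equations = cartesianProductWith _≐_ ts ts
    ∈builtIns : IsEnumeration (setoid (BuiltIn Σ')) (equations ++ true ∷ false ∷ [])
    ∈builtIns (s ≐ t) =
      ∈-++⁺ˡ (∈-cartesianProductWith⁺ _≐_ (proj₂ Term-enumerable s) (proj₂ Term-enumerable t))
    ∈builtIns true    = ∈-++⁺ʳ equations (here refl)
    ∈builtIns false   = ∈-++⁺ʳ equations (there (here refl))

  Constraint-enumerable : Enumerable (Constraint Σ')
  Constraint-enumerable = map bi bs ++ map chr cs , ∈constraints
    where
    bs : List (BuiltIn Σ')
    bs = proj₁ BuiltIn-enumerable
    cs : List (CHRC Σ')
    cs = proj₁ CHRC-enumerable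
    ∈constraints : IsEnumeration (setoid (Constraint Σ')) (map bi bs ++ map chr cs)
    ∈constraints (bi b)  = ∈-++⁺ˡ (∈-map⁺ bi (proj₂ BuiltIn-enumerable b))
    ∈constraints (chr c) = ∈-++⁺ʳ (map bi bs) (∈-map⁺ chr (proj₂ CHRC-enumerable c))

module _ {A : Set} {P : U.Pred A 0ℓ} (P? : U.Decidable P) where

  filter-nonempty⇒Any : ∀ xs → 0 < length (filter P? xs) → Any P xs
  filter-nonempty⇒Any (x ∷ xs) pos with P? x
  ... | yes px = here px
  ... | no _   = there (filter-nonempty⇒Any xs pos)

  Any-resp-length-filter : ∀ {xs ys} → Any P xs →
    length (filter P? xs) ≤ length (filter P? ys) → Any P ys
  Any-resp-length-filter {ys = ys} pxs ≤ys =
    filter-nonempty⇒Any ys (<-≤-trans (filter-some P? pxs) ≤ys)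

module _ {A B : Set} where

  ∈⇒Any-proj₁ : ∀ {a b} {abs : List (A × B)} → (a , b) ∈ abs → Any ((a ≡_) ∘ proj₁) abs
  ∈⇒Any-proj₁ = Any.map (cong proj₁)

  Any-proj₁⇒∈ : ∀ {a} {abs : List (A × B)} →
    Any ((a ≡_) ∘ proj₁) abs → ∃ λ b → (a , b) ∈ abs
  Any-proj₁⇒∈ p with (_ , b) , ab∈abs , refl ← find p = b , ab∈abs

module _ {Σ' : Sig} where

  mult-≤⇒∈ : ∀ {c G₁ G₂} → c ∈ G₁ → mult {Σ'} c G₁ ≤ mult c G₂ → c ∈ G₂
  mult-≤⇒∈ {c} = Any-resp-length-filter (c ≟K_)

  idcount-≤⇒∈ : ∀ {c S₁ S₂} → (∃ λ i → (c , i) ∈ S₁) → idcount {Σ'} c S₁ ≤ idcount c S₂ →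
    ∃ λ i → (c , i) ∈ S₂
  idcount-≤⇒∈ {c} (_ , ci∈S₁) ≤S₂ =
    Any-proj₁⇒∈ (Any-resp-length-filter ((c ≟C_) ∘ proj₁) (∈⇒Any-proj₁ ci∈S₁) ≤S₂)

  open DecMembership (_≟B_ {Σ'}) using (_∈?_)

  occurs : BuiltIn Σ' → List (BuiltIn Σ') → Bool
  occurs b B = isYes (b ∈? B)

  same-occurrences⇒⊆ : ∀ {B₁ B₂} → (∀ b → occurs b B₁ ≡ occurs b B₂) → B₁ ⊆ B₂
  same-occurrences⇒⊆ same {b} b∈B₁ = toWitness (subst T (same b) (fromWitness b∈B₁))

  module _ {K : Set} (ι : Fin (nc Σ') → K) where

    ⊆-antisym⇒≡CT : ∀ {B₁ B₂} → B₁ ⊆ B₂ → B₂ ⊆ B₁ → _≡CT_ {Σ'} ι B₁ B₂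
    ⊆-antisym⇒≡CT B₁⊆B₂ B₂⊆B₁ ρ = mk⇔ (anti-mono B₂⊆B₁) (anti-mono B₁⊆B₂)

module _ {Σ' : Sig} where

  _≼_ : Rel (Conf Σ') 0ℓ
  C₁ ≼ C₂ = (∀ c → mult c (goal C₁) ≤ mult c (goal C₂))
          × (∀ c → idcount c (store C₁) ≤ idcount c (store C₂))
          × (∀ b → occurs b (bstore C₁) ≡ occurs b (bstore C₂))

  ≼-almostFull : AlmostFull _≼_
  ≼-almostFull =
    almostFull-∩ (coordinatewise (Constraint-enumerable Σ') (λ c → mult c ∘ goal) ≤-almostFull)
      (almostFull-∩ (coordinatewise (CHRC-enumerable Σ') (λ c → idcount c ∘ store) ≤-almostFull)
        (coordinatewise (BuiltIn-enumerable Σ') (λ b → occurs b ∘ bstore) ≡-almostFull-Bool))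
    where
    coordinatewise : {I A : Set} {R : Rel A 0ℓ} → Enumerable I → (f : I → Conf Σ' → A) →
      AlmostFull R → AlmostFull (λ C₁ C₂ → ∀ i → R (f i C₁) (f i C₂))
    coordinatewise enum f af = almostFull-∀ enum λ i → almostFull-on (f i) af

  module _ {K : Set} (ι : Fin (nc Σ') → K) where

    ≼⇒⊑ : _≼_ ⇒ _⊑_ {Σ'} ι
    ≼⇒⊑ (≤goal , ≤store , same) =
        (λ c _ → ≤goal c)
      , (λ c _ → ≤store c)
      , ⊆-antisym⇒≡CT {Σ'} ι (same-occurrences⇒⊆ same) (same-occurrences⇒⊆ (sym ∘ same))

    ⊑-refl : ∀ C → _⊑_ {Σ'} ι C C
    ⊑-refl C = (λ _ _ → ≤-refl) , (λ _ _ → ≤-refl) , λ _ → ⇔-id _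

    ⊑-trans : ∀ {C₁ C₂ C₃} → _⊑_ {Σ'} ι C₁ C₂ → _⊑_ {Σ'} ι C₂ C₃ → _⊑_ {Σ'} ι C₁ C₃
    ⊑-trans (≤goal₁ , ≤store₁ , ≡B₁) (≤goal₂ , ≤store₂ , ≡B₂) =
        (λ c c∈G₁ → let ≤₁ = ≤goal₁ c c∈G₁ in ≤-trans ≤₁ (≤goal₂ c (mult-≤⇒∈ c∈G₁ ≤₁)))
      , (λ c c∈S₁ → let ≤₁ = ≤store₁ c c∈S₁ in ≤-trans ≤₁ (≤store₂ c (idcount-≤⇒∈ c∈S₁ ≤₁)))
      , λ ρ → ≡B₂ ρ ⇔-∘ ≡B₁ ρ

lemma4 : (Σ' : Sig) (K : Set) (ι : Fin (nc Σ') → K) → Injective _≡_ _≡_ ι →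
    IsWQO (_⊑_ {Σ'} {K} ι)
lemma4 Σ' K ι _ = almostFull⇒IsWQO ≼-almostFull
  (λ {C₁} {C₂} → ≼⇒⊑ ι {C₁} {C₂})
  (⊑-refl ι)
  (λ {C₁} {C₂} {C₃} → ⊑-trans ι {C₁} {C₂} {C₃})
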